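{- For nonnegative integers $m,n$ and a number $x$ with $2x+m\neq 0$, \[ \sum_{a=1}^{m}\sum_{b=1}^{n}\binom{x+m-a+b-1}{n+b-1}\binom{x+a-b-1}{n-b}=\frac{mn}{2x+m}\binom{2x+m}{2n}. \]
   Context: For an arbitrary (complex) number $z$ and an integer $k$, $\binom{z}{k}=\frac{z(z-1)\cdots(z-k+1)}{k!}$ for $k\ge0$ and $\binom{z}{k}=0$ for $k<0$. An empty sum equals $0$. -}

module Defs where

open import Level using (Level; _⊔_) renaming (suc to lsuc)
open import Data.Nat using (ℕ; zero; suc; _!) renaming (_+_ to _+ℕ_; _*_ to _*ℕ_)
open import Relation.Binary.PropositionalEquality using (_≡_)
open import Relation.Nullary using (¬_)
open import Algebra.Bundles using (CommutativeRing)
import Algebra.Definitions.RawMonoid as RawMonoidDefs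

-- A field of characteristic zero: a commutative ring with a (total) inverse
-- operation that is a genuine multiplicative inverse on nonzero elements,
-- and in which n·1 = 0 only for n = 0 (this also forces 1 ≠ 0).
-- The complex numbers (the paper's setting) are an instance.
record CharZeroField (c ℓ : Level) : Set (lsuc (c ⊔ ℓ)) where
  field
    commRing : CommutativeRing c ℓ
  open CommutativeRing commRing public
  open RawMonoidDefs +-rawMonoid public using (_×_)
  field
    _⁻¹      : Carrier → Carrier
    inverseʳ : ∀ x → ¬ (x ≈ 0#) → x * (x ⁻¹) ≈ 1#
    charZero : ∀ n → n × 1# ≈ 0# → n ≡ 0

module _ {c ℓ} (F : CharZeroField c ℓ) where
  open CharZeroField F

  ι : ℕ → Carrier
  ι n = n × 1#

  falling : Carrier → ℕ → Carrier
  falling z zero    = 1#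
  falling z (suc k) = falling z k * (z - ι k)

  -- generalized binomial coefficient (z choose k) = z(z-1)...(z-k+1) / k!  for k ≥ 0
  -- (all lower indices in the theorem are nonnegative)
  binom : Carrier → ℕ → Carrier
  binom z k = falling z k * ((ι (k !)) ⁻¹)

  sum1 : ℕ → (ℕ → Carrier) → Carrier
  sum1 zero    f = 0#
  sum1 (suc m) f = sum1 m f + f (suc m)

{-# OPTIONS --safe #-}

-- Write binom z k as the multiset coefficient ((w, k)) = w (w + 1) ⋯ (w + k - 1) / k! with
-- w = z - k + 1. For n = n′ + 1, U = x + m - a - n′ and V = x + a - n′ - 1 the inner sum
-- for a becomes ∑_{i ≤ n′} ((U, n + i)) ((V, n′ - i)): the terms i ≥ n of the Chu–Vandermonde
-- sum ∑_{i + j = 2n - 1} ((U, i)) ((V, j)) = ((U + V, 2n - 1)). The reflection a ↦ m + 1 - a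
-- swaps U and V and so supplies the terms i < n; hence twice the left side is
-- m ((2x + m - 2n + 1, 2n - 1)), which the absorption identity
-- 2n binom(y, 2n) = y ((y - 2n + 1, 2n - 1)) for y = 2x + m identifies with twice the right side.
-- Vandermonde itself follows by induction from the product rule for formal power series,
-- as the formal derivative of ∑ ((u, i)) tⁱ has coefficients ((u, i)) (u + i).

module Submission where

open import Defs

open import Data.Integer as ℤ using (ℤ; +_; -[1+_]; _⊖_)
import Data.Integer.Properties as ℤ
open import Data.Maybe using (just; nothing)
open import Data.Nat as ℕ using (ℕ; zero; suc; _≤_; _<_; _!)
  renaming (_+_ to _+ℕ_; _*_ to _*ℕ_; _∸_ to _∸ℕ_)
import Data.Nat.Properties as ℕ
open import Relation.Binary.Definitions using (WeaklyDecidable)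
open import Relation.Binary.PropositionalEquality as ≡ using (_≡_; _≢_)
open import Relation.Nullary using (yes; no; ¬_)
open import Algebra.Bundles using (CommutativeRing)
open import Algebra.Solver.Ring.AlmostCommutativeRing
  using (fromCommutativeRing; _-Raw-AlmostCommutative⟶_)

module IntegerCoefficientSolver {c ℓ} (R : CommutativeRing c ℓ) where
  open CommutativeRing R
  open import Algebra.Properties.Ring ring
    using (-0#≈0#; -‿involutive; -‿+-comm; -‿distribˡ-*; -‿distribʳ-*)
  open import Algebra.Properties.CommutativeSemigroup +-commutativeSemigroup
    using (interchange)
  open import Algebra.Properties.Semiring.Mult.TCOptimised semiring
    using (_×_; 1+×; ×-homo-+; ×1-homo-*)
  open import Relation.Binary.Reasoning.Setoid setoid

  -- The optimised _×_ makes con (+ 1) denote 1# itself rather than 1# + 0#.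
  fromℤ : ℤ → Carrier
  fromℤ (+ n)    = n × 1#
  fromℤ -[1+ n ] = - (suc n × 1#)

  fromℤ-neg : ∀ i → fromℤ (ℤ.- i) ≈ - fromℤ i
  fromℤ-neg (+ zero)  = sym -0#≈0#
  fromℤ-neg (+ suc n) = refl
  fromℤ-neg -[1+ n ]  = sym (-‿involutive _)

  fromℤ-⊖ : ∀ m n → fromℤ (m ⊖ n) ≈ m × 1# - n × 1#
  fromℤ-⊖ m       zero    = sym (trans (+-congˡ -0#≈0#) (+-identityʳ _))
  fromℤ-⊖ zero    (suc n) = sym (+-identityˡ _)
  fromℤ-⊖ (suc m) (suc n) = begin
    fromℤ (suc m ⊖ suc n)          ≡⟨ ≡.cong fromℤ (ℤ.[1+m]⊖[1+n]≡m⊖n m n) ⟩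
    fromℤ (m ⊖ n)                  ≈⟨ fromℤ-⊖ m n ⟩
    a - b                          ≈⟨ +-identityˡ _ ⟨
    0# + (a - b)                   ≈⟨ +-congʳ (-‿inverseʳ 1#) ⟨
    (1# - 1#) + (a - b)            ≈⟨ interchange 1# a (- 1#) (- b) ⟨
    (1# + a) + (- 1# - b)          ≈⟨ +-congˡ (-‿+-comm 1# b) ⟩
    (1# + a) - (1# + b)            ≈⟨ +-cong (1+× m 1#) (-‿cong (1+× n 1#)) ⟨
    suc m × 1# - suc n × 1#        ∎
    where
    a = m × 1#
    b = n × 1#

  fromℤ-+ : ∀ i j → fromℤ (i ℤ.+ j) ≈ fromℤ i + fromℤ j
  fromℤ-+ (+ m)    (+ n)    = ×-homo-+ 1# m n
  fromℤ-+ (+ m)    -[1+ n ] = fromℤ-⊖ m (suc n)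
  fromℤ-+ -[1+ m ] (+ n)    = trans (fromℤ-⊖ n (suc m)) (+-comm _ _)
  fromℤ-+ -[1+ m ] -[1+ n ] = begin
    - (suc (suc (m +ℕ n)) × 1#)     ≡⟨ ≡.cong (λ k → - (suc k × 1#)) (ℕ.+-suc m n) ⟨
    - ((suc m +ℕ suc n) × 1#)       ≈⟨ -‿cong (×-homo-+ 1# (suc m) (suc n)) ⟩
    - (suc m × 1# + suc n × 1#)     ≈⟨ -‿+-comm _ _ ⟨
    - (suc m × 1#) - (suc n × 1#)   ∎

  fromℤ-pos-* : ∀ m n → fromℤ (+ m ℤ.* + n) ≈ (m × 1#) * (n × 1#)
  fromℤ-pos-* m n = trans (reflexive (≡.cong fromℤ (≡.sym (ℤ.pos-* m n)))) (×1-homo-* m n)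

  fromℤ-* : ∀ i j → fromℤ (i ℤ.* j) ≈ fromℤ i * fromℤ j
  fromℤ-* (+ m) (+ n) = fromℤ-pos-* m n
  fromℤ-* (+ m) -[1+ n ] = begin
    fromℤ (+ m ℤ.* -[1+ n ])           ≡⟨ ≡.cong fromℤ (ℤ.neg-distribʳ-* (+ m) (+ suc n)) ⟨
    fromℤ (ℤ.- (+ m ℤ.* + suc n))      ≈⟨ fromℤ-neg (+ m ℤ.* + suc n) ⟩
    - fromℤ (+ m ℤ.* + suc n)          ≈⟨ -‿cong (fromℤ-pos-* m (suc n)) ⟩
    - (m × 1# * suc n × 1#)            ≈⟨ -‿distribʳ-* _ _ ⟩
    m × 1# * - (suc n × 1#)            ∎
  fromℤ-* -[1+ m ] (+ n) = begin
    fromℤ (-[1+ m ] ℤ.* + n)           ≡⟨ ≡.cong fromℤ (ℤ.neg-distribˡ-* (+ suc m) (+ n)) ⟨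
    fromℤ (ℤ.- (+ suc m ℤ.* + n))      ≈⟨ fromℤ-neg (+ suc m ℤ.* + n) ⟩
    - fromℤ (+ suc m ℤ.* + n)          ≈⟨ -‿cong (fromℤ-pos-* (suc m) n) ⟩
    - (suc m × 1# * n × 1#)            ≈⟨ -‿distribˡ-* _ _ ⟩
    - (suc m × 1#) * n × 1#            ∎
  fromℤ-* -[1+ m ] -[1+ n ] = begin
    fromℤ (-[1+ m ] ℤ.* -[1+ n ])      ≡⟨ ≡.cong fromℤ (ℤ.neg-distribˡ-* (+ suc m) -[1+ n ]) ⟨
    fromℤ (ℤ.- (+ suc m ℤ.* -[1+ n ])) ≈⟨ fromℤ-neg (+ suc m ℤ.* -[1+ n ]) ⟩
    - fromℤ (+ suc m ℤ.* -[1+ n ])     ≈⟨ -‿cong (fromℤ-* (+ suc m) -[1+ n ]) ⟩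
    - (suc m × 1# * - (suc n × 1#))    ≈⟨ -‿distribˡ-* _ _ ⟩
    - (suc m × 1#) * - (suc n × 1#)    ∎

  fromℤ-homomorphism : ℤ.+-*-rawRing -Raw-AlmostCommutative⟶ fromCommutativeRing R
  fromℤ-homomorphism = record
    { ⟦_⟧    = fromℤ
    ; +-homo = fromℤ-+
    ; *-homo = fromℤ-*
    ; -‿homo = fromℤ-neg
    ; 0-homo = refl
    ; 1-homo = refl
    }

  fromℤ-≟ : WeaklyDecidable (λ i j → fromℤ i ≈ fromℤ j)
  fromℤ-≟ i j with i ℤ.≟ j
  ... | yes ≡.refl = just refl
  ... | no _       = nothing

  open import Algebra.Solver.Ring ℤ.+-*-rawRing (fromCommutativeRing R) fromℤ-homomorphism fromℤ-≟
    public

module FormalPowerSeries {c ℓ} (R : CommutativeRing c ℓ) where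
  open CommutativeRing R
  open import Algebra.Definitions.RawMonoid +-rawMonoid using (_×_)
  open import Algebra.Properties.Monoid.Mult +-monoid using (×-homo-+)
  open import Algebra.Properties.CommutativeSemigroup +-commutativeSemigroup using (interchange)
  open import Algebra.Properties.CommutativeSemigroup *-commutativeSemigroup using (x∙yz≈y∙xz)
  open import Relation.Binary.Reasoning.Setoid setoid
  open IntegerCoefficientSolver R using (solve; _:=_; _:+_; _:*_; con)

  ∑ : ℕ → (ℕ → Carrier) → Carrier
  ∑ zero    h = 0#
  ∑ (suc K) h = ∑ K h + h K

  syntax ∑ K (λ i → e) = ∑[ i < K ] e

  ∑-cong : ∀ K {h g : ℕ → Carrier} → (∀ i → i < K → h i ≈ g i) → ∑ K h ≈ ∑ K g
  ∑-cong zero    h≈g = refl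
  ∑-cong (suc K) h≈g =
    +-cong (∑-cong K (λ i i<K → h≈g i (ℕ.m<n⇒m<1+n i<K))) (h≈g K (ℕ.n<1+n K))

  ∑-distrib-+ : ∀ K h g → ∑[ i < K ] (h i + g i) ≈ ∑ K h + ∑ K g
  ∑-distrib-+ zero    h g = sym (+-identityʳ 0#)
  ∑-distrib-+ (suc K) h g = trans (+-congʳ (∑-distrib-+ K h g)) (interchange _ _ _ _)

  ∑-distribʳ-* : ∀ K h a → ∑[ i < K ] (h i * a) ≈ ∑ K h * a
  ∑-distribʳ-* zero    h a = sym (zeroˡ a)
  ∑-distribʳ-* (suc K) h a = trans (+-congʳ (∑-distribʳ-* K h a)) (sym (distribʳ a _ _))

  ∑-distribˡ-* : ∀ K h a → ∑[ i < K ] (a * h i) ≈ a * ∑ K h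
  ∑-distribˡ-* zero    h a = sym (zeroʳ a)
  ∑-distribˡ-* (suc K) h a = trans (+-congʳ (∑-distribˡ-* K h a)) (sym (distribˡ a _ _))

  ∑-const : ∀ K t → ∑[ i < K ] t ≈ (K × 1#) * t
  ∑-const zero    t = sym (zeroˡ t)
  ∑-const (suc K) t = trans (+-congʳ (∑-const K t))
    (solve 2 (λ k t → k :* t :+ t := (con (+ 1) :+ k) :* t) refl (K × 1#) t)

  ∑-head : ∀ K h → ∑ (suc K) h ≈ h 0 + ∑[ i < K ] h (suc i)
  ∑-head zero    h = +-comm _ _
  ∑-head (suc K) h = trans (+-congʳ (∑-head K h)) (+-assoc _ _ _)

  ∑-split : ∀ A B h → ∑ (A +ℕ B) h ≈ ∑ A h + ∑[ i < B ] h (A +ℕ i)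
  ∑-split A zero    h rewrite ℕ.+-identityʳ A = sym (+-identityʳ _)
  ∑-split A (suc B) h rewrite ℕ.+-suc A B = trans (+-congʳ (∑-split A B h)) (+-assoc _ _ _)

  ∑-reverse : ∀ K h → ∑ K h ≈ ∑[ i < K ] h (K ∸ℕ suc i)
  ∑-reverse zero    h = refl
  ∑-reverse (suc K) h = begin
    ∑ K h + h K                            ≈⟨ +-congʳ (∑-reverse K h) ⟩
    ∑[ i < K ] h (K ∸ℕ suc i) + h K         ≈⟨ +-comm _ _ ⟩
    h K + ∑[ i < K ] h (K ∸ℕ suc i)         ≈⟨ ∑-head K (λ i → h (K ∸ℕ i)) ⟨
    ∑[ i < suc K ] h (suc K ∸ℕ suc i)       ∎

  ×1-split : ∀ {i K} → i ≤ K → K × 1# ≈ i × 1# + (K ∸ℕ i) × 1#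
  ×1-split {i} {K} i≤K = trans (reflexive (≡.cong (_× 1#) (≡.sym (ℕ.m+[n∸m]≡n i≤K))))
                                (×-homo-+ 1# i (K ∸ℕ i))

  -- f ⋆ g and deriv f are the coefficient sequences of the product of the power series
  -- ∑ f i tⁱ and ∑ g i tⁱ, and of the formal derivative of ∑ f i tⁱ.
  infixl 7 _⋆_

  _⋆_ : (ℕ → Carrier) → (ℕ → Carrier) → ℕ → Carrier
  (f ⋆ g) K = ∑[ i < suc K ] (f i * g (K ∸ℕ i))

  deriv : (ℕ → Carrier) → ℕ → Carrier
  deriv f i = (suc i × 1#) * f (suc i)

  ⋆-leibniz : ∀ f g K → (suc K × 1#) * (f ⋆ g) (suc K) ≈ (deriv f ⋆ g) K + (f ⋆ deriv g) K
  ⋆-leibniz f g K = begin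
    (suc K × 1#) * ∑ (suc (suc K)) T
      ≈⟨ ∑-distribˡ-* (suc (suc K)) T _ ⟨
    ∑[ i < suc (suc K) ] ((suc K × 1#) * T i)
      ≈⟨ ∑-cong (suc (suc K)) split ⟩
    ∑[ i < suc (suc K) ] ((i × 1#) * T i + ((suc K ∸ℕ i) × 1#) * T i)
      ≈⟨ ∑-distrib-+ (suc (suc K)) _ _ ⟩
    ∑[ i < suc (suc K) ] ((i × 1#) * T i) + ∑[ i < suc (suc K) ] (((suc K ∸ℕ i) × 1#) * T i)
      ≈⟨ +-cong left right ⟩
    (deriv f ⋆ g) K + (f ⋆ deriv g) K ∎
    where
    T : ℕ → Carrier
    T i = f i * g (suc K ∸ℕ i)

    split : ∀ i → i < suc (suc K) →
            (suc K × 1#) * T i ≈ (i × 1#) * T i + ((suc K ∸ℕ i) × 1#) * T i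
    split i i<2+K = trans (*-congʳ (×1-split (ℕ.≤-pred i<2+K))) (distribʳ _ _ _)

    left : ∑[ i < suc (suc K) ] ((i × 1#) * T i) ≈ (deriv f ⋆ g) K
    left = begin
      ∑[ i < suc (suc K) ] ((i × 1#) * T i)
        ≈⟨ ∑-head (suc K) _ ⟩
      0# * T 0 + ∑[ i < suc K ] ((suc i × 1#) * T (suc i))
        ≈⟨ trans (+-congʳ (zeroˡ _)) (+-identityˡ _) ⟩
      ∑[ i < suc K ] ((suc i × 1#) * T (suc i))
        ≈⟨ ∑-cong (suc K) (λ i _ → sym (*-assoc _ _ _)) ⟩
      (deriv f ⋆ g) K ∎

    absorb-weight : ∀ i → i ≤ K → ((suc K ∸ℕ i) × 1#) * T i ≈ f i * deriv g (K ∸ℕ i)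
    absorb-weight i i≤K rewrite ℕ.+-∸-assoc 1 i≤K = x∙yz≈y∙xz _ _ _

    right : ∑[ i < suc (suc K) ] (((suc K ∸ℕ i) × 1#) * T i) ≈ (f ⋆ deriv g) K
    right = begin
      ∑[ i < suc K ] (((suc K ∸ℕ i) × 1#) * T i) + ((K ∸ℕ K) × 1#) * T (suc K)
        ≈⟨ +-congˡ (trans (*-congʳ (reflexive (≡.cong (_× 1#) (ℕ.n∸n≡0 K)))) (zeroˡ _)) ⟩
      ∑[ i < suc K ] (((suc K ∸ℕ i) × 1#) * T i) + 0#
        ≈⟨ +-identityʳ _ ⟩
      ∑[ i < suc K ] (((suc K ∸ℕ i) × 1#) * T i)
        ≈⟨ ∑-cong (suc K) (λ i i<1+K → absorb-weight i (ℕ.≤-pred i<1+K)) ⟩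
      (f ⋆ deriv g) K ∎

  ⋆-index-weights : ∀ f g a b K →
    ((λ i → f i * (a + i × 1#)) ⋆ g) K + (f ⋆ (λ j → g j * (b + j × 1#))) K
      ≈ (f ⋆ g) K * (a + b + K × 1#)
  ⋆-index-weights f g a b K = begin
    ((λ i → f i * (a + i × 1#)) ⋆ g) K + (f ⋆ (λ j → g j * (b + j × 1#))) K
      ≈⟨ ∑-distrib-+ (suc K) _ _ ⟨
    ∑[ i < suc K ] (f i * (a + i × 1#) * g (K ∸ℕ i) + f i * (g (K ∸ℕ i) * (b + (K ∸ℕ i) × 1#)))
      ≈⟨ ∑-cong (suc K) (λ i i<1+K → pointwise i (ℕ.≤-pred i<1+K)) ⟩
    ∑[ i < suc K ] (f i * g (K ∸ℕ i) * (a + b + K × 1#))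
      ≈⟨ ∑-distribʳ-* (suc K) _ _ ⟩
    (f ⋆ g) K * (a + b + K × 1#) ∎
    where
    pointwise : ∀ i → i ≤ K →
      f i * (a + i × 1#) * g (K ∸ℕ i) + f i * (g (K ∸ℕ i) * (b + (K ∸ℕ i) × 1#))
        ≈ f i * g (K ∸ℕ i) * (a + b + K × 1#)
    pointwise i i≤K = trans
      (solve 6 (λ F G a b p q → F :* (a :+ p) :* G :+ F :* (G :* (b :+ q)) := F :* G :* (a :+ b :+ (p :+ q)))
             refl (f i) (g (K ∸ℕ i)) a b (i × 1#) ((K ∸ℕ i) × 1#))
      (*-congˡ (+-congˡ (sym (×1-split i≤K))))

  ⋆-cong : ∀ {f f′ g g′} K → (∀ i → f i ≈ f′ i) → (∀ j → g j ≈ g′ j) →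
           (f ⋆ g) K ≈ (f′ ⋆ g′) K
  ⋆-cong K f≈f′ g≈g′ = ∑-cong (suc K) (λ i _ → *-cong (f≈f′ i) (g≈g′ _))

module CharZero {c ℓ} (F : CharZeroField c ℓ) where
  open CharZeroField F
  open IntegerCoefficientSolver commRing using (solve; _:=_; _:+_; _:-_; _:*_; con)
  open FormalPowerSeries commRing
  open import Algebra.Properties.Monoid.Mult +-monoid using (×-homo-+)
  open import Algebra.Properties.Semiring.Mult semiring using (×1-homo-*)
  open import Relation.Binary.Reasoning.Setoid setoid

  ι≉0 : ∀ {k} → k ≢ 0 → ¬ ι F k ≈ 0#
  ι≉0 k≢0 ιk≈0 = k≢0 (charZero _ ιk≈0)

  ι[1+k]≉0 : ∀ k → ¬ ι F (suc k) ≈ 0#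
  ι[1+k]≉0 k = ι≉0 {suc k} (λ ())

  ι[k!]≉0 : ∀ k → ¬ ι F (k !) ≈ 0#
  ι[k!]≉0 k = ι≉0 (ℕ.≢-nonZero⁻¹ (k !) {{k ℕ.!≢0}})

  ι-+ : ∀ i j → ι F (i +ℕ j) ≈ ι F i + ι F j
  ι-+ = ×-homo-+ 1#

  ι-* : ∀ i j → ι F (i *ℕ j) ≈ ι F i * ι F j
  ι-* = ×1-homo-*

  *-cancelˡ-≉0 : ∀ {z x y} → ¬ z ≈ 0# → z * x ≈ z * y → x ≈ y
  *-cancelˡ-≉0 {z} {x} {y} z≉0 zx≈zy = begin
    x                  ≈⟨ *-identityˡ x ⟨
    1# * x             ≈⟨ *-congʳ z⁻¹z≈1 ⟨
    z ⁻¹ * z * x       ≈⟨ *-assoc _ _ _ ⟩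
    z ⁻¹ * (z * x)     ≈⟨ *-congˡ zx≈zy ⟩
    z ⁻¹ * (z * y)     ≈⟨ *-assoc _ _ _ ⟨
    z ⁻¹ * z * y       ≈⟨ *-congʳ z⁻¹z≈1 ⟩
    1# * y             ≈⟨ *-identityˡ y ⟩
    y                  ∎
    where
    z⁻¹z≈1 : z ⁻¹ * z ≈ 1#
    z⁻¹z≈1 = trans (*-comm _ _) (inverseʳ z z≉0)

  ι[2]*x≈x+x : ∀ z → ι F 2 * z ≈ z + z
  ι[2]*x≈x+x = solve 1 (λ z → (con (+ 1) :+ (con (+ 1) :+ con (+ 0))) :* z := z :+ z) refl

  x+x≈y+y⇒x≈y : ∀ {x y} → x + x ≈ y + y → x ≈ y
  x+x≈y+y⇒x≈y {x} {y} x+x≈y+y = *-cancelˡ-≉0 (ι[1+k]≉0 1)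
    (trans (ι[2]*x≈x+x x) (trans x+x≈y+y (sym (ι[2]*x≈x+x y))))

  ⁻¹-unique : ∀ {z w} → ¬ z ≈ 0# → z * w ≈ 1# → w ≈ z ⁻¹
  ⁻¹-unique z≉0 zw≈1 = *-cancelˡ-≉0 z≉0 (trans zw≈1 (sym (inverseʳ _ z≉0)))

  ι[0!]⁻¹≈1 : ι F (0 !) ⁻¹ ≈ 1#
  ι[0!]⁻¹≈1 = sym (⁻¹-unique (ι[k!]≉0 0) (trans (*-identityʳ _) (+-identityʳ 1#)))

  ι[1+k]*ι[1+k]!⁻¹≈ι[k!]⁻¹ : ∀ k → ι F (suc k) * ι F (suc k !) ⁻¹ ≈ ι F (k !) ⁻¹
  ι[1+k]*ι[1+k]!⁻¹≈ι[k!]⁻¹ k = ⁻¹-unique (ι[k!]≉0 k) (begin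
    ι F (k !) * (ι F (suc k) * ι F (suc k !) ⁻¹)
      ≈⟨ *-assoc _ _ _ ⟨
    ι F (k !) * ι F (suc k) * ι F (suc k !) ⁻¹
      ≈⟨ *-congʳ (trans (*-comm _ _) (sym (ι-* (suc k) (k !)))) ⟩
    ι F (suc k !) * ι F (suc k !) ⁻¹
      ≈⟨ inverseʳ _ (ι[k!]≉0 (suc k)) ⟩
    1# ∎)

  rising : Carrier → ℕ → Carrier
  rising z zero    = 1#
  rising z (suc k) = rising z k * (z + ι F k)

  rising-cong : ∀ k {z w} → z ≈ w → rising z k ≈ rising w k
  rising-cong zero    z≈w = refl
  rising-cong (suc k) z≈w = *-cong (rising-cong k z≈w) (+-congʳ z≈w)

  rising-sucˡ : ∀ w k → rising w (suc k) ≈ w * rising (w + 1#) k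
  rising-sucˡ w zero    = solve 1 (λ w → con (+ 1) :* (w :+ con (+ 0)) := w :* con (+ 1)) refl w
  rising-sucˡ w (suc k) = begin
    rising w (suc k) * (w + ι F (suc k))          ≈⟨ *-congʳ (rising-sucˡ w k) ⟩
    w * rising (w + 1#) k * (w + ι F (suc k))     ≈⟨ solve 3 (λ w r t → w :* r :* (w :+ (con (+ 1) :+ t))
                                                               := w :* (r :* ((w :+ con (+ 1)) :+ t)))
                                                           refl w (rising (w + 1#) k) (ι F k) ⟩
    w * (rising (w + 1#) k * ((w + 1#) + ι F k))  ∎

  falling≈rising : ∀ z k → falling F z k ≈ rising (z - ι F k + 1#) k
  falling≈rising z zero    = refl
  falling≈rising z (suc k) = begin
    falling F z k * (z - ι F k)                           ≈⟨ *-congʳ (falling≈rising z k) ⟩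
    rising (z - ι F k + 1#) k * (z - ι F k)               ≈⟨ *-comm _ _ ⟩
    (z - ι F k) * rising (z - ι F k + 1#) k               ≈⟨ rising-sucˡ (z - ι F k) k ⟨
    rising (z - ι F k) (suc k)                            ≈⟨ rising-cong (suc k) (solve 2 (λ z t →
                                                               z :- t := z :- (con (+ 1) :+ t) :+ con (+ 1))
                                                               refl z (ι F k)) ⟩
    rising (z - ι F (suc k) + 1#) (suc k)                 ∎

  -- multichoose z k = binom (z + k - 1) k.
  multichoose : Carrier → ℕ → Carrier
  multichoose z k = rising z k * ι F (k !) ⁻¹

  multichoose-cong : ∀ k {z w} → z ≈ w → multichoose z k ≈ multichoose w k
  multichoose-cong k z≈w = *-congʳ (rising-cong k z≈w)

  multichoose-zero : ∀ z → multichoose z 0 ≈ 1#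
  multichoose-zero z = trans (*-identityˡ _) ι[0!]⁻¹≈1

  deriv-multichoose : ∀ z k → deriv (multichoose z) k ≈ multichoose z k * (z + ι F k)
  deriv-multichoose z k = begin
    ι F (suc k) * (rising z k * (z + ι F k) * ι F (suc k !) ⁻¹)
      ≈⟨ solve 4 (λ s r t d → s :* (r :* t :* d) := r :* (s :* d) :* t)
               refl (ι F (suc k)) (rising z k) (z + ι F k) (ι F (suc k !) ⁻¹) ⟩
    rising z k * (ι F (suc k) * ι F (suc k !) ⁻¹) * (z + ι F k)
      ≈⟨ *-congʳ (*-congˡ (ι[1+k]*ι[1+k]!⁻¹≈ι[k!]⁻¹ k)) ⟩
    multichoose z k * (z + ι F k) ∎

  binom≈multichoose : ∀ {z w} k → w + ι F k ≈ z + 1# → binom F z k ≈ multichoose w k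
  binom≈multichoose {z} {w} k w+k≈z+1 = *-congʳ (trans (falling≈rising z k) (rising-cong k (begin
    z - ι F k + 1#          ≈⟨ solve 3 (λ z t o → z :- t :+ o := (z :+ o) :- t) refl z (ι F k) 1# ⟩
    (z + 1#) - ι F k        ≈⟨ +-congʳ w+k≈z+1 ⟨
    (w + ι F k) - ι F k     ≈⟨ solve 2 (λ w t → (w :+ t) :- t := w) refl w (ι F k) ⟩
    w                       ∎)))

  vandermonde : ∀ u v K → (multichoose u ⋆ multichoose v) K ≈ multichoose (u + v) K
  vandermonde u v zero = begin
    0# + multichoose u 0 * multichoose v 0  ≈⟨ +-identityˡ _ ⟩
    multichoose u 0 * multichoose v 0       ≈⟨ *-cong (multichoose-zero u) (multichoose-zero v) ⟩
    1# * 1#                                 ≈⟨ *-identityˡ 1# ⟩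
    1#                                      ≈⟨ multichoose-zero (u + v) ⟨
    multichoose (u + v) 0                   ∎
  vandermonde u v (suc K) = *-cancelˡ-≉0 (ι[1+k]≉0 K) (begin
    ι F (suc K) * (multichoose u ⋆ multichoose v) (suc K)
      ≈⟨ ⋆-leibniz (multichoose u) (multichoose v) K ⟩
    (deriv (multichoose u) ⋆ multichoose v) K + (multichoose u ⋆ deriv (multichoose v)) K
      ≈⟨ +-cong (⋆-cong {g = multichoose v} K (deriv-multichoose u) (λ _ → refl))
                (⋆-cong {f = multichoose u} K (λ _ → refl) (deriv-multichoose v)) ⟩
    ((λ i → multichoose u i * (u + ι F i)) ⋆ multichoose v) K
      + (multichoose u ⋆ (λ j → multichoose v j * (v + ι F j))) K
      ≈⟨ ⋆-index-weights (multichoose u) (multichoose v) u v K ⟩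
    (multichoose u ⋆ multichoose v) K * (u + v + ι F K)
      ≈⟨ *-congʳ (vandermonde u v K) ⟩
    multichoose (u + v) K * (u + v + ι F K)
      ≈⟨ deriv-multichoose (u + v) K ⟨
    ι F (suc K) * multichoose (u + v) (suc K) ∎)

  -- The terms i ≥ n′ + 1 of (multichoose u ⋆ multichoose v) (2 n′ + 1).
  upperHalf : Carrier → Carrier → ℕ → Carrier
  upperHalf u v n′ = ∑[ i < suc n′ ] (multichoose u (suc n′ +ℕ i) * multichoose v (n′ ∸ℕ i))

  upperHalf-cong : ∀ n′ {u u′ v v′} → u ≈ u′ → v ≈ v′ → upperHalf u v n′ ≈ upperHalf u′ v′ n′
  upperHalf-cong n′ u≈u′ v≈v′ = ∑-cong (suc n′) (λ i _ →
    *-cong (multichoose-cong (suc n′ +ℕ i) u≈u′) (multichoose-cong (n′ ∸ℕ i) v≈v′))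

  upperHalf-swap : ∀ u v n′ →
                   upperHalf u v n′ + upperHalf v u n′ ≈ multichoose (u + v) (n′ +ℕ suc n′)
  upperHalf-swap u v n′ = begin
    upperHalf u v n′ + upperHalf v u n′       ≈⟨ +-comm _ _ ⟩
    upperHalf v u n′ + upperHalf u v n′       ≈⟨ +-cong lower upper ⟨
    ∑ n h + ∑[ i < n ] h (n +ℕ i)            ≈⟨ ∑-split n n h ⟨
    (multichoose u ⋆ multichoose v) K         ≈⟨ vandermonde u v K ⟩
    multichoose (u + v) K                     ∎
    where
    n = suc n′
    K = n′ +ℕ n

    h : ℕ → Carrier
    h i = multichoose u i * multichoose v (K ∸ℕ i)

    K∸[n+i] : ∀ i → K ∸ℕ (n +ℕ i) ≡ n′ ∸ℕ i
    K∸[n+i] i = ≡.trans (≡.cong (_∸ℕ (n +ℕ i)) (ℕ.+-comm n′ n)) (ℕ.[m+n]∸[m+o]≡n∸o n n′ i)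

    K∸[n′∸i] : ∀ {i} → i ≤ n′ → K ∸ℕ (n′ ∸ℕ i) ≡ n +ℕ i
    K∸[n′∸i] {i} i≤n′ = ≡.trans (ℕ.+-∸-comm n (ℕ.m∸n≤m n′ i))
      (≡.trans (≡.cong (_+ℕ n) (ℕ.m∸[m∸n]≡n i≤n′)) (ℕ.+-comm i n))

    upper : ∑[ i < n ] h (n +ℕ i) ≈ upperHalf u v n′
    upper = ∑-cong n (λ i _ → *-congˡ (reflexive (≡.cong (multichoose v) (K∸[n+i] i))))

    lower : ∑ n h ≈ upperHalf v u n′
    lower = trans (∑-reverse n h) (∑-cong n (λ i i<n →
      trans (*-comm _ _) (*-congʳ (reflexive (≡.cong (multichoose v) (K∸[n′∸i] (ℕ.≤-pred i<n)))))))

  sum1≈∑ : ∀ m f → sum1 F m f ≈ ∑[ i < m ] f (suc i)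
  sum1≈∑ zero    f = refl
  sum1≈∑ (suc m) f = +-congʳ (sum1≈∑ m f)

  module DoubleSum (m n′ : ℕ) (x : Carrier) where
    n K : ℕ
    n = suc n′
    K = n′ +ℕ n

    y : Carrier
    y = ι F 2 * x + ι F m

    U V : Carrier → Carrier
    U α = x + ι F m - α - ι F n′
    V α = x + α - ι F n′ - 1#

    inner : Carrier → Carrier
    inner α = sum1 F n (λ b →
        binom F (x + ι F m - α + ι F b - 1#) (n +ℕ b ∸ℕ 1)
      * binom F (x + α - ι F b - 1#) (n ∸ℕ b))

    inner≈upperHalf : ∀ α → inner α ≈ upperHalf (U α) (V α) n′
    inner≈upperHalf α = trans (sum1≈∑ n _)
      (∑-cong n (λ i i<n → *-cong (first i) (second i (ℕ.≤-pred i<n))))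
      where
      first : ∀ i → binom F (x + ι F m - α + ι F (suc i) - 1#) (n′ +ℕ suc i)
                      ≈ multichoose (U α) (n +ℕ i)
      first i = trans (binom≈multichoose (n′ +ℕ suc i) (begin
        U α + ι F (n′ +ℕ suc i)                ≈⟨ +-congˡ (ι-+ n′ (suc i)) ⟩
        U α + (ι F n′ + ι F (suc i))           ≈⟨ solve 5 (λ x M a N I →
                                                     x :+ M :- a :- N :+ (N :+ (con (+ 1) :+ I))
                                                  := x :+ M :- a :+ (con (+ 1) :+ I) :- con (+ 1) :+ con (+ 1))
                                                  refl x (ι F m) α (ι F n′) (ι F i) ⟩
        x + ι F m - α + ι F (suc i) - 1# + 1#  ∎))
        (reflexive (≡.cong (multichoose (U α)) (ℕ.+-suc n′ i)))

      second : ∀ i → i ≤ n′ → binom F (x + α - ι F (suc i) - 1#) (n′ ∸ℕ i)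
                                ≈ multichoose (V α) (n′ ∸ℕ i)
      second i i≤n′ = binom≈multichoose (n′ ∸ℕ i) (begin
        V α + ι F (n′ ∸ℕ i)
          ≈⟨ +-congʳ (+-congʳ (+-congˡ (-‿cong (×1-split i≤n′)))) ⟩
        x + α - (ι F i + ι F (n′ ∸ℕ i)) - 1# + ι F (n′ ∸ℕ i)
          ≈⟨ solve 4 (λ x a I D → x :+ a :- (I :+ D) :- con (+ 1) :+ D
                                 := x :+ a :- (con (+ 1) :+ I) :- con (+ 1) :+ con (+ 1))
                     refl x α (ι F i) (ι F (n′ ∸ℕ i)) ⟩
        x + α - ι F (suc i) - 1# + 1# ∎)

    U+V≈y-K : ∀ α → U α + V α ≈ y - ι F K
    U+V≈y-K α = begin
      U α + V α             ≈⟨ solve 4 (λ x M a N →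
                                    x :+ M :- a :- N :+ (x :+ a :- N :- con (+ 1))
                                 := (con (+ 1) :+ (con (+ 1) :+ con (+ 0))) :* x :+ M :- (N :+ (con (+ 1) :+ N)))
                                 refl x (ι F m) α (ι F n′) ⟩
      y - (ι F n′ + ι F n)  ≈⟨ +-congˡ (-‿cong (ι-+ n′ n)) ⟨
      y - ι F K             ∎

    inner-pair : ∀ {α β} → α + β ≈ 1# + ι F m → inner α + inner β ≈ multichoose (y - ι F K) K
    inner-pair {α} {β} α+β≈1+m = begin
      inner α + inner β
        ≈⟨ +-cong (inner≈upperHalf α) (inner≈upperHalf β) ⟩
      upperHalf (U α) (V α) n′ + upperHalf (U β) (V β) n′
        ≈⟨ +-congˡ (upperHalf-cong n′ Uβ≈Vα Vβ≈Uα) ⟩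
      upperHalf (U α) (V α) n′ + upperHalf (V α) (U α) n′
        ≈⟨ upperHalf-swap (U α) (V α) n′ ⟩
      multichoose (U α + V α) K
        ≈⟨ multichoose-cong K (U+V≈y-K α) ⟩
      multichoose (y - ι F K) K ∎
      where
      β≈1+m-α : β ≈ 1# + ι F m - α
      β≈1+m-α = trans (solve 2 (λ a b → b := a :+ b :- a) refl α β) (+-congʳ α+β≈1+m)

      Uβ≈Vα : U β ≈ V α
      Uβ≈Vα = trans (+-congʳ (+-congˡ (-‿cong β≈1+m-α)))
        (solve 4 (λ x M a N → x :+ M :- (con (+ 1) :+ M :- a) :- N := x :+ a :- N :- con (+ 1))
               refl x (ι F m) α (ι F n′))

      Vβ≈Uα : V β ≈ U α
      Vβ≈Uα = trans (+-congʳ (+-congʳ (+-congˡ β≈1+m-α)))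
        (solve 4 (λ x M a N → x :+ (con (+ 1) :+ M :- a) :- N :- con (+ 1) := x :+ M :- a :- N)
               refl x (ι F m) α (ι F n′))

    lhs rhs : Carrier
    lhs = sum1 F m (λ a → inner (ι F a))
    rhs = (ι F (m *ℕ n) * y ⁻¹) * binom F y (2 *ℕ n)

    twice-lhs : lhs + lhs ≈ ι F m * multichoose (y - ι F K) K
    twice-lhs = begin
      lhs + lhs
        ≈⟨ +-cong (sum1≈∑ m _) (trans (sum1≈∑ m _) (∑-reverse m _)) ⟩
      ∑[ i < m ] inner (ι F (suc i)) + ∑[ i < m ] inner (ι F (suc (m ∸ℕ suc i)))
        ≈⟨ ∑-distrib-+ m _ _ ⟨
      ∑[ i < m ] (inner (ι F (suc i)) + inner (ι F (suc (m ∸ℕ suc i))))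
        ≈⟨ ∑-cong m (λ i i<m → inner-pair (mirror i<m)) ⟩
      ∑[ i < m ] multichoose (y - ι F K) K
        ≈⟨ ∑-const m _ ⟩
      ι F m * multichoose (y - ι F K) K ∎
      where
      mirror : ∀ {i} → i < m → ι F (suc i) + ι F (suc (m ∸ℕ suc i)) ≈ 1# + ι F m
      mirror {i} i<m = begin
        ι F (suc i) + (1# + ι F (m ∸ℕ suc i))  ≈⟨ solve 3 (λ a o b → a :+ (o :+ b) := o :+ (a :+ b))
                                                         refl (ι F (suc i)) 1# (ι F (m ∸ℕ suc i)) ⟩
        1# + (ι F (suc i) + ι F (m ∸ℕ suc i))  ≈⟨ +-congˡ (×1-split i<m) ⟨
        1# + ι F m                             ∎

    twice-rhs : ¬ y ≈ 0# → rhs + rhs ≈ ι F m * multichoose (y - ι F K) K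
    twice-rhs y≉0 = begin
      rhs + rhs
        ≈⟨ ι[2]*x≈x+x rhs ⟨
      ι F 2 * ((ι F (m *ℕ n) * y ⁻¹) * binom F y (2 *ℕ n))
        ≈⟨ *-congˡ (*-cong (*-congʳ (ι-* m n)) binom[y,2n]≈M[1+K]) ⟩
      ι F 2 * ((ι F m * ι F n * y ⁻¹) * M (suc K))
        ≈⟨ solve 5 (λ t a b c d → t :* ((a :* b :* c) :* d) := a :* c :* ((t :* b) :* d))
                 refl (ι F 2) (ι F m) (ι F n) (y ⁻¹) (M (suc K)) ⟩
      ι F m * y ⁻¹ * ((ι F 2 * ι F n) * M (suc K))
        ≈⟨ *-congˡ (*-congʳ (trans (sym (ι-* 2 n)) (reflexive (≡.cong (ι F) 2n≡1+K)))) ⟩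
      ι F m * y ⁻¹ * (ι F (suc K) * M (suc K))
        ≈⟨ *-congˡ (deriv-multichoose W K) ⟩
      ι F m * y ⁻¹ * (M K * (W + ι F K))
        ≈⟨ *-congˡ (*-congˡ (solve 2 (λ y k → y :- k :+ k := y) refl y (ι F K))) ⟩
      ι F m * y ⁻¹ * (M K * y)
        ≈⟨ solve 4 (λ a c d e → a :* c :* (d :* e) := a :* d :* (e :* c))
                 refl (ι F m) (y ⁻¹) (M K) y ⟩
      ι F m * M K * (y * y ⁻¹)
        ≈⟨ *-congˡ (inverseʳ y y≉0) ⟩
      ι F m * M K * 1#
        ≈⟨ *-identityʳ _ ⟩
      ι F m * M K ∎
      where
      W = y - ι F K
      M = multichoose W

      2n≡1+K : 2 *ℕ n ≡ suc K
      2n≡1+K = ≡.cong (n +ℕ_) (ℕ.+-identityʳ n)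

      binom[y,2n]≈M[1+K] : binom F y (2 *ℕ n) ≈ M (suc K)
      binom[y,2n]≈M[1+K] = trans (reflexive (≡.cong (binom F y) 2n≡1+K))
        (binom≈multichoose (suc K)
          (solve 2 (λ y k → y :- k :+ (con (+ 1) :+ k) := y :+ con (+ 1)) refl y (ι F K)))

mainTheorem9 : ∀ {c ℓ} (F : CharZeroField c ℓ) → let open CharZeroField F in
    (m n : ℕ) (x : Carrier) → ¬ ((ι F 2 * x + ι F m) ≈ 0#) →
    sum1 F m (λ a → sum1 F n (λ b →
        binom F (x + ι F m - ι F a + ι F b - 1#) (n +ℕ b ∸ℕ 1)
      * binom F (x + ι F a - ι F b - 1#) (n ∸ℕ b)))
    ≈ (ι F (m *ℕ n) * ((ι F 2 * x + ι F m) ⁻¹)) * binom F (ι F 2 * x + ι F m) (2 *ℕ n)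
mainTheorem9 F m zero x _ = begin
  sum1 F m (λ _ → 0#)                ≈⟨ sum1≈∑ m _ ⟩
  ∑[ i < m ] 0#                      ≈⟨ trans (∑-const m 0#) (zeroʳ _) ⟩
  0#                                 ≈⟨ trans (*-congʳ (zeroˡ _)) (zeroˡ _) ⟨
  ι F 0 * y ⁻¹ * binom F y 0         ≡⟨ ≡.cong (λ k → ι F k * y ⁻¹ * binom F y 0) (ℕ.*-zeroʳ m) ⟨
  ι F (m *ℕ 0) * y ⁻¹ * binom F y 0  ∎
  where
  open CharZeroField F
  open CharZero F
  open FormalPowerSeries commRing using (∑; ∑-const)
  open import Relation.Binary.Reasoning.Setoid setoid
  y = ι F 2 * x + ι F m
mainTheorem9 F m (suc n′) x y≉0 = x+x≈y+y⇒x≈y (trans twice-lhs (sym (twice-rhs y≉0)))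
  where
  open CharZeroField F
  open CharZero F
  open DoubleSum m n′ x
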